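{- Let $T$ be a strongly consistent $\mathcal{L}$-theory of $RGL^*$. Then there exist a first-order language $\hat{\mathcal{L}}\supseteq\mathcal{L}$ and a maximally strongly consistent Henkin $\hat{\mathcal{L}}$-theory $\hat T$ with $T\subseteq\hat T$.
   Context: Syntax. Fix a first-order language $\mathcal{L}$ with countably many predicate, function and constant symbols. Formulas of $RGL^*$ are built from atomic formulas and nullary connectives $\bar r$, one for each $r\in[0,1]\cap\mathbb{Q}$ (including $\bar0,\bar1$), using $\wedge,\to,\forall,\exists$; an $\mathcal{L}$-theory is a set of sentences. Abbreviations: $\neg\varphi:=\varphi\to\bar1$; $\varphi\vee\psi:=((\varphi\to\psi)\to\psi)\wedge((\psi\to\varphi)\to\varphi)$; $\varphi\leftrightarrow\psi:=(\varphi\to\psi)\wedge(\psi\to\varphi)$. Proof system (for any language). Axioms (all formulas $\varphi,\psi,\chi$, rationals $r,s\in[0,1]$): (G1) $(\varphi\to\psi)\to((\psi\to\chi)\to(\varphi\to\chi))$; (G2) $(\varphi\wedge\psi)\to\varphi$; (G3) $(\varphi\wedge\psi)\to(\psi\wedge\varphi)$; (G4) $\varphi\to(\varphi\wedge\varphi)$; (G5) $(\varphi\to(\psi\to\chi))\leftrightarrow((\varphi\wedge\psi)\to\chi)$; (G6) $((\varphi\to\psi)\to\chi)\to(((\psi\to\varphi)\to\chi)\to\chi)$; (G7) $\bar1\to\varphi$; (G$\forall$1) $(\forall x\,\varphi(x))\to\varphi(t)$, $t$ substitutable; (G$\forall$2) $(\forall x(\psi\to\varphi(x)))\to(\psi\to\forall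 x\,\varphi(x))$, $x$ not free in $\psi$; (G$\forall$3) $(\forall x(\psi\vee\varphi(x)))\to(\psi\vee\forall x\,\varphi(x))$, $x$ not free in $\psi$; (G$\exists$1) $\varphi(t)\to\exists x\,\varphi(x)$; (G$\exists$2) $(\exists x(\psi\to\varphi(x)))\to(\psi\to\exists x\,\varphi(x))$, $x$ not free in $\psi$; (RGL1) $(\bar r\wedge\bar s)\leftrightarrow\overline{\max\{r,s\}}$; (RGL2) $\bar r\to\bar s$ if $r\ge s$, and $(\bar r\to\bar s)\leftrightarrow\bar s$ if $r<s$; (RGL3) $\neg\neg\bar r$ for $r<1$. Rules: modus ponens and generalization. $T\vdash\varphi$ means derivable from the axioms and $T$. A theory is strongly consistent if it does not prove $\bar r$ for any rational $r>0$; it is maximally strongly consistent (in its language) if it is strongly consistent and not properly contained in any strongly consistent theory of the same language. An $\hat{\mathcal{L}}$-theory $\Sigma$ is Henkin if whenever $\Sigma\nvdash\forall x\,\varphi(x)$ (for an $\hat{\mathcal{L}}$-formula $\varphi(x)$), there is a constant symbol $c\in\hat{\mathcal{L}}$ with $\Sigma\nvdash\varphi(c)$. -}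

module Defs where

open import Level using (0ℓ)
open import Data.Nat using (ℕ; zero; suc)
open import Data.Fin using (Fin; zero; suc)
open import Data.Vec using (Vec; []; _∷_)
open import Data.Product using (Σ; _×_; _,_; ∃; proj₁)
open import Data.Rational using (ℚ; 0ℚ; 1ℚ; _⊔_; _≤_; _<_)
open import Data.Rational.Properties using (_≤?_; ⊔-lub; ≤-refl)
open import Relation.Nullary using (¬_)
open import Relation.Nullary.Decidable using (toWitness)
open import Function.Definitions using (Injective)
open import Relation.Binary.PropositionalEquality using (_≡_)

record ℚ01 : Set where
  constructor ⟨_,_,_⟩
  field
    val : ℚ
    lo  : 0ℚ ≤ val
    hi  : val ≤ 1ℚ
open ℚ01 public

max01 : ℚ01 → ℚ01 → ℚ01
max01 ⟨ r , r0 , r1 ⟩ ⟨ s , s0 , s1 ⟩ =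
  ⟨ r ⊔ s , Data.Rational.Properties.≤-trans r0 (Data.Rational.Properties.p≤p⊔q r s) , ⊔-lub r1 s1 ⟩

one01 : ℚ01
one01 = ⟨ 1ℚ , toWitness {a? = 0ℚ ≤? 1ℚ} _ , ≤-refl ⟩

Countable : Set → Set
Countable A = Σ (A → ℕ) λ f → Injective _≡_ _≡_ f

record Language : Set₁ where
  field
    Pred  : ℕ → Set
    Fun   : ℕ → Set
    Const : Set
    Pred-countable  : ∀ k → Countable (Pred k)
    Fun-countable   : ∀ k → Countable (Fun k)
    Const-countable : Countable Const
open Language public

record _⊑_ (L L̂ : Language) : Set where
  field
    predᵉ  : ∀ {k} → Pred L k → Pred L̂ k
    funᵉ   : ∀ {k} → Fun L k → Fun L̂ k
    constᵉ : Const L → Const L̂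
    predᵉ-inj  : ∀ {k} → Injective _≡_ _≡_ (predᵉ {k})
    funᵉ-inj   : ∀ {k} → Injective _≡_ _≡_ (funᵉ {k})
    constᵉ-inj : Injective _≡_ _≡_ constᵉ
open _⊑_ public

-- Terms and formulas (well-scoped de Bruijn; n = number of free variables)

module _ (L : Language) where
  data Term (n : ℕ) : Set where
    var   : Fin n → Term n
    const : Const L → Term n
    app   : ∀ {k} → Fun L k → Vec (Term n) k → Term n

  data Formula (n : ℕ) : Set where
    atom : ∀ {k} → Pred L k → Vec (Term n) k → Formula n
    rc   : ℚ01 → Formula n                 -- the truth constant r̄
    _∧̇_  : Formula n → Formula n → Formula n
    _⇒_  : Formula n → Formula n → Formula n
    ∀̇    : Formula (suc n) → Formula n     -- binds variable 0
    ∃̇    : Formula (suc n) → Formula n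

  infixr 6 _∧̇_
  infixr 5 _⇒_

  Sentence : Set
  Sentence = Formula 0

  Theory : Set₁
  Theory = Sentence → Set


module _ {L : Language} where
  renT  : ∀ {n m} → (Fin n → Fin m) → Term L n → Term L m
  renTs : ∀ {n m k} → (Fin n → Fin m) → Vec (Term L n) k → Vec (Term L m) k
  renT ρ (var i)    = var (ρ i)
  renT ρ (const c)  = const c
  renT ρ (app f ts) = app f (renTs ρ ts)
  renTs ρ []       = []
  renTs ρ (t ∷ ts) = renT ρ t ∷ renTs ρ ts

  extR : ∀ {n m} → (Fin n → Fin m) → Fin (suc n) → Fin (suc m)
  extR ρ zero    = zero
  extR ρ (suc i) = suc (ρ i)

  renF : ∀ {n m} → (Fin n → Fin m) → Formula L n → Formula L m
  renF ρ (atom P ts) = atom P (renTs ρ ts)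
  renF ρ (rc r)      = rc r
  renF ρ (φ ∧̇ ψ)     = renF ρ φ ∧̇ renF ρ ψ
  renF ρ (φ ⇒ ψ)     = renF ρ φ ⇒ renF ρ ψ
  renF ρ (∀̇ φ)       = ∀̇ (renF (extR ρ) φ)
  renF ρ (∃̇ φ)       = ∃̇ (renF (extR ρ) φ)

  wk : ∀ {n} → Formula L n → Formula L (suc n)
  wk = renF suc

  emb : ∀ {n} → Sentence L → Formula L n
  emb = renF (λ ())

  subT  : ∀ {n m} → (Fin n → Term L m) → Term L n → Term L m
  subTs : ∀ {n m k} → (Fin n → Term L m) → Vec (Term L n) k → Vec (Term L m) k
  subT σ (var i)    = σ i
  subT σ (const c)  = const c
  subT σ (app f ts) = app f (subTs σ ts)
  subTs σ []       = []
  subTs σ (t ∷ ts) = subT σ t ∷ subTs σ ts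

  extS : ∀ {n m} → (Fin n → Term L m) → Fin (suc n) → Term L (suc m)
  extS σ zero    = var zero
  extS σ (suc i) = renT suc (σ i)

  subF : ∀ {n m} → (Fin n → Term L m) → Formula L n → Formula L m
  subF σ (atom P ts) = atom P (subTs σ ts)
  subF σ (rc r)      = rc r
  subF σ (φ ∧̇ ψ)     = subF σ φ ∧̇ subF σ ψ
  subF σ (φ ⇒ ψ)     = subF σ φ ⇒ subF σ ψ
  subF σ (∀̇ φ)       = ∀̇ (subF (extS σ) φ)
  subF σ (∃̇ φ)       = ∃̇ (subF (extS σ) φ)

  _[_] : ∀ {n} → Formula L (suc n) → Term L n → Formula L n
  φ [ t ] = subF (λ { zero → t ; (suc i) → var i }) φ

  ¬̇_ : ∀ {n} → Formula L n → Formula L n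
  ¬̇ φ = φ ⇒ rc one01

  _∨̇_ : ∀ {n} → Formula L n → Formula L n → Formula L n
  φ ∨̇ ψ = ((φ ⇒ ψ) ⇒ ψ) ∧̇ ((ψ ⇒ φ) ⇒ φ)

  _⇔_ : ∀ {n} → Formula L n → Formula L n → Formula L n
  φ ⇔ ψ = (φ ⇒ ψ) ∧̇ (ψ ⇒ φ)

module _ {L L̂ : Language} (ι : L ⊑ L̂) where
  trT  : ∀ {n} → Term L n → Term L̂ n
  trTs : ∀ {n k} → Vec (Term L n) k → Vec (Term L̂ n) k
  trT (var i)    = var i
  trT (const c)  = const (constᵉ ι c)
  trT (app f ts) = app (funᵉ ι f) (trTs ts)
  trTs []       = []
  trTs (t ∷ ts) = trT t ∷ trTs ts

  trF : ∀ {n} → Formula L n → Formula L̂ n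
  trF (atom P ts) = atom (predᵉ ι P) (trTs ts)
  trF (rc r)      = rc r
  trF (φ ∧̇ ψ)     = trF φ ∧̇ trF ψ
  trF (φ ⇒ ψ)     = trF φ ⇒ trF ψ
  trF (∀̇ φ)       = ∀̇ (trF φ)
  trF (∃̇ φ)       = ∃̇ (trF φ)

module _ {L : Language} where
  data Axiom {n : ℕ} : Formula L n → Set where
    G1 : ∀ φ ψ χ → Axiom ((φ ⇒ ψ) ⇒ ((ψ ⇒ χ) ⇒ (φ ⇒ χ)))
    G2 : ∀ φ ψ → Axiom ((φ ∧̇ ψ) ⇒ φ)
    G3 : ∀ φ ψ → Axiom ((φ ∧̇ ψ) ⇒ (ψ ∧̇ φ))
    G4 : ∀ φ → Axiom (φ ⇒ (φ ∧̇ φ))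
    G5 : ∀ φ ψ χ → Axiom ((φ ⇒ (ψ ⇒ χ)) ⇔ ((φ ∧̇ ψ) ⇒ χ))
    G6 : ∀ φ ψ χ → Axiom (((φ ⇒ ψ) ⇒ χ) ⇒ (((ψ ⇒ φ) ⇒ χ) ⇒ χ))
    G7 : ∀ φ → Axiom (rc one01 ⇒ φ)
    G∀1 : ∀ (φ : Formula L (suc n)) (t : Term L n) → Axiom (∀̇ φ ⇒ (φ [ t ]))
    G∀2 : ∀ (ψ : Formula L n) (φ : Formula L (suc n)) →
          Axiom (∀̇ (wk ψ ⇒ φ) ⇒ (ψ ⇒ ∀̇ φ))
    G∀3 : ∀ (ψ : Formula L n) (φ : Formula L (suc n)) →
          Axiom (∀̇ (wk ψ ∨̇ φ) ⇒ (ψ ∨̇ ∀̇ φ))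
    G∃1 : ∀ (φ : Formula L (suc n)) (t : Term L n) → Axiom ((φ [ t ]) ⇒ ∃̇ φ)
    G∃2 : ∀ (ψ : Formula L n) (φ : Formula L (suc n)) →
          Axiom (∃̇ (wk ψ ⇒ φ) ⇒ (ψ ⇒ ∃̇ φ))
    RGL1  : ∀ r s → Axiom ((rc r ∧̇ rc s) ⇔ rc (max01 r s))
    RGL2≥ : ∀ r s → val s ≤ val r → Axiom (rc r ⇒ rc s)
    RGL2< : ∀ r s → val r < val s → Axiom ((rc r ⇒ rc s) ⇔ rc s)
    RGL3  : ∀ r → val r < 1ℚ → Axiom (¬̇ ¬̇ rc r)

  data _⊢_ (T : Theory L) : {n : ℕ} → Formula L n → Set where
    ax  : ∀ {n} {φ : Formula L n} → Axiom φ → T ⊢ φ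
    hyp : ∀ {n} {φ : Sentence L} → T φ → T ⊢ emb {n = n} φ
    mp  : ∀ {n} {φ ψ : Formula L n} → T ⊢ φ → T ⊢ (φ ⇒ ψ) → T ⊢ ψ
    gen : ∀ {n} {φ : Formula L (suc n)} → T ⊢ φ → T ⊢ ∀̇ φ

  infix 4 _⊢_

module _ {L : Language} where
  _⊆ᵀ_ : Theory L → Theory L → Set
  T ⊆ᵀ T' = ∀ φ → T φ → T' φ

  StronglyConsistent : Theory L → Set
  StronglyConsistent T = ∀ (r : ℚ01) → 0ℚ < val r → ¬ (T ⊢ rc {n = 0} r)

  MaximallyStronglyConsistent : Theory L → Set₁
  MaximallyStronglyConsistent T =
    StronglyConsistent T ×
    (∀ (T' : Theory L) → T ⊆ᵀ T' → StronglyConsistent T' → T' ⊆ᵀ T)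

  Henkin : Theory L → Set
  Henkin Σ' = ∀ (φ : Formula L 1) → ¬ (Σ' ⊢ ∀̇ φ) →
              ∃ λ (c : Const L) → ¬ (Σ' ⊢ (φ [ const c ]))

_⊆[_]_ : {L L̂ : Language} → Theory L → L ⊑ L̂ → Theory L̂ → Set
T ⊆[ ι ] T̂ = ∀ φ → T φ → T̂ (trF ι φ)

module Submission where

-- Add countably many fresh constants cⱼ and run Lindenbaum's construction along an
-- enumeration of all sentences, adding a sentence whenever strong consistency survives.
-- When ∀x φ has to be rejected, the current theory refutes it to some degree r > 0, and we
-- add φ(cⱼ) → s̄ with 0 < s < r for a cⱼ not used so far; by the constants lemma,
-- prelinearity and G∀3 this keeps strong consistency.  The union is strongly consistent by
-- compactness of derivations, maximal because every sentence was considered at some stage,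
-- and Henkin because every unprovable ∀x φ received a witness cⱼ with φ(cⱼ) → s̄.

open import Defs
open import Level using (0ℓ)
open import Data.Nat using (ℕ; zero; suc; _+_; _⊔_; _≤′_; ≤′-refl; ≤′-step; z≤n; s≤s)
  renaming (_≤_ to _≤ℕ_; _<_ to _<ℕ_)
open import Data.Nat.Properties as ℕ using (m≤m⊔n; m≤n⊔m; ⊔-lub; n≤1+n; _≟_)
open import Data.Fin using (Fin; zero; suc; toℕ)
open import Data.Fin.Properties using (toℕ-injective)
open import Data.Vec using (Vec; []; _∷_)
open import Data.Product using (Σ; _×_; _,_; proj₁; proj₂; ∃)
open import Data.Sum using (_⊎_; inj₁; inj₂)
open import Data.Sum.Properties using (inj₁-injective; inj₂-injective)
open import Data.Empty using (⊥; ⊥-elim)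
open import Data.Integer using (ℤ; +_; -[1+_])
open import Data.Rational using (ℚ; mkℚ; 0ℚ; _<_)
import Data.Rational.Properties as ℚ
open import Relation.Nullary using (¬_; Dec; yes; no)
open import Relation.Binary using (tri<; tri≈; tri>)
open import Relation.Binary.PropositionalEquality
  using (_≡_; _≢_; refl; sym; trans; cong; cong₂; subst)
open import Axiom.ExcludedMiddle using (ExcludedMiddle)

record SymbolMap (L L′ : Language) : Set where
  field
    onPred : ∀ {k} → Pred L k → Pred L′ k
    onFun  : ∀ {k} → Fun L k → Fun L′ k
open SymbolMap

idˢ : ∀ {L} → SymbolMap L L
idˢ = record { onPred = λ P → P ; onFun = λ f → f }

_∘ˢ_ : ∀ {L₁ L₂ L₃} → SymbolMap L₂ L₃ → SymbolMap L₁ L₂ → SymbolMap L₁ L₃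
μ ∘ˢ ν = record { onPred = λ P → onPred μ (onPred ν P) ; onFun = λ f → onFun μ (onFun ν f) }

⇑ᶜ : ∀ {A : Set} {L m} → (A → Term L m) → A → Term L (suc m)
⇑ᶜ γ c = renT suc (γ c)

extS-cong : ∀ {L n m} {σ σ′ : Fin n → Term L m} → (∀ i → σ i ≡ σ′ i) → ∀ i → extS σ i ≡ extS σ′ i
extS-cong eσ zero    = refl
extS-cong eσ (suc i) = cong (renT suc) (eσ i)

-- Renaming, substitution and translation along L ⊑ L̂ are all instances of mapF.
module _ {L L′ : Language} (μ : SymbolMap L L′) where
  mapT  : ∀ {n m} → (Fin n → Term L′ m) → (Const L → Term L′ m) → Term L n → Term L′ m
  mapTs : ∀ {n m k} → (Fin n → Term L′ m) → (Const L → Term L′ m) →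
          Vec (Term L n) k → Vec (Term L′ m) k
  mapT σ γ (var i)    = σ i
  mapT σ γ (const c)  = γ c
  mapT σ γ (app f ts) = app (onFun μ f) (mapTs σ γ ts)
  mapTs σ γ []       = []
  mapTs σ γ (t ∷ ts) = mapT σ γ t ∷ mapTs σ γ ts

  mapF : ∀ {n m} → (Fin n → Term L′ m) → (Const L → Term L′ m) → Formula L n → Formula L′ m
  mapF σ γ (atom P ts) = atom (onPred μ P) (mapTs σ γ ts)
  mapF σ γ (rc r)      = rc r
  mapF σ γ (φ ∧̇ ψ)     = mapF σ γ φ ∧̇ mapF σ γ ψ
  mapF σ γ (φ ⇒ ψ)     = mapF σ γ φ ⇒ mapF σ γ ψ
  mapF σ γ (∀̇ φ)       = ∀̇ (mapF (extS σ) (⇑ᶜ γ) φ)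
  mapF σ γ (∃̇ φ)       = ∃̇ (mapF (extS σ) (⇑ᶜ γ) φ)

  mapT-cong  : ∀ {n m} {σ σ′ : Fin n → Term L′ m} {γ γ′ : Const L → Term L′ m} →
               (∀ i → σ i ≡ σ′ i) → (∀ c → γ c ≡ γ′ c) → ∀ t → mapT σ γ t ≡ mapT σ′ γ′ t
  mapTs-cong : ∀ {n m k} {σ σ′ : Fin n → Term L′ m} {γ γ′ : Const L → Term L′ m} →
               (∀ i → σ i ≡ σ′ i) → (∀ c → γ c ≡ γ′ c) →
               (ts : Vec (Term L n) k) → mapTs σ γ ts ≡ mapTs σ′ γ′ ts
  mapT-cong eσ eγ (var i)    = eσ i
  mapT-cong eσ eγ (const c)  = eγ c
  mapT-cong eσ eγ (app f ts) = cong (app (onFun μ f)) (mapTs-cong eσ eγ ts)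
  mapTs-cong eσ eγ []       = refl
  mapTs-cong eσ eγ (t ∷ ts) = cong₂ _∷_ (mapT-cong eσ eγ t) (mapTs-cong eσ eγ ts)

  mapF-cong : ∀ {n m} {σ σ′ : Fin n → Term L′ m} {γ γ′ : Const L → Term L′ m} →
              (∀ i → σ i ≡ σ′ i) → (∀ c → γ c ≡ γ′ c) → ∀ φ → mapF σ γ φ ≡ mapF σ′ γ′ φ
  mapF-cong eσ eγ (atom P ts) = cong (atom (onPred μ P)) (mapTs-cong eσ eγ ts)
  mapF-cong eσ eγ (rc r)      = refl
  mapF-cong eσ eγ (φ ∧̇ ψ)     = cong₂ _∧̇_ (mapF-cong eσ eγ φ) (mapF-cong eσ eγ ψ)
  mapF-cong eσ eγ (φ ⇒ ψ)     = cong₂ _⇒_ (mapF-cong eσ eγ φ) (mapF-cong eσ eγ ψ)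
  mapF-cong eσ eγ (∀̇ φ)       = cong ∀̇ (mapF-cong (extS-cong eσ) (λ c → cong (renT suc) (eγ c)) φ)
  mapF-cong eσ eγ (∃̇ φ)       = cong ∃̇ (mapF-cong (extS-cong eσ) (λ c → cong (renT suc) (eγ c)) φ)

renT-renT  : ∀ {L n m p} (ρ : Fin m → Fin p) (π : Fin n → Fin m) (t : Term L n) →
             renT ρ (renT π t) ≡ renT (λ i → ρ (π i)) t
renTs-renTs : ∀ {L n m p k} (ρ : Fin m → Fin p) (π : Fin n → Fin m) (ts : Vec (Term L n) k) →
              renTs ρ (renTs π ts) ≡ renTs (λ i → ρ (π i)) ts
renT-renT ρ π (var i)    = refl
renT-renT ρ π (const c)  = refl
renT-renT ρ π (app f ts) = cong (app f) (renTs-renTs ρ π ts)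
renTs-renTs ρ π []       = refl
renTs-renTs ρ π (t ∷ ts) = cong₂ _∷_ (renT-renT ρ π t) (renTs-renTs ρ π ts)

module _ {L L′ : Language} (μ : SymbolMap L L′) where
  mapT-renT  : ∀ {n n′ m} (σ : Fin n′ → Term L′ m) (γ : Const L → Term L′ m)
               (ρ : Fin n → Fin n′) (t : Term L n) →
               mapT μ σ γ (renT ρ t) ≡ mapT μ (λ i → σ (ρ i)) γ t
  mapTs-renTs : ∀ {n n′ m k} (σ : Fin n′ → Term L′ m) (γ : Const L → Term L′ m)
                (ρ : Fin n → Fin n′) (ts : Vec (Term L n) k) →
                mapTs μ σ γ (renTs ρ ts) ≡ mapTs μ (λ i → σ (ρ i)) γ ts
  mapT-renT σ γ ρ (var i)    = refl
  mapT-renT σ γ ρ (const c)  = refl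
  mapT-renT σ γ ρ (app f ts) = cong (app (onFun μ f)) (mapTs-renTs σ γ ρ ts)
  mapTs-renTs σ γ ρ []       = refl
  mapTs-renTs σ γ ρ (t ∷ ts) = cong₂ _∷_ (mapT-renT σ γ ρ t) (mapTs-renTs σ γ ρ ts)

  renT-mapT  : ∀ {n m m′} (ρ : Fin m → Fin m′) (σ : Fin n → Term L′ m) (γ : Const L → Term L′ m)
               (t : Term L n) →
               renT ρ (mapT μ σ γ t) ≡ mapT μ (λ i → renT ρ (σ i)) (λ c → renT ρ (γ c)) t
  renTs-mapTs : ∀ {n m m′ k} (ρ : Fin m → Fin m′) (σ : Fin n → Term L′ m)
                (γ : Const L → Term L′ m) (ts : Vec (Term L n) k) →
                renTs ρ (mapTs μ σ γ ts) ≡ mapTs μ (λ i → renT ρ (σ i)) (λ c → renT ρ (γ c)) ts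
  renT-mapT ρ σ γ (var i)    = refl
  renT-mapT ρ σ γ (const c)  = refl
  renT-mapT ρ σ γ (app f ts) = cong (app (onFun μ f)) (renTs-mapTs ρ σ γ ts)
  renTs-mapTs ρ σ γ []       = refl
  renTs-mapTs ρ σ γ (t ∷ ts) = cong₂ _∷_ (renT-mapT ρ σ γ t) (renTs-mapTs ρ σ γ ts)

  mapT-weaken : ∀ {m p} (σ : Fin m → Term L′ p) (γ : Const L → Term L′ p) (t : Term L m) →
                mapT μ (extS σ) (⇑ᶜ γ) (renT suc t) ≡ renT suc (mapT μ σ γ t)
  mapT-weaken σ γ t = trans (mapT-renT (extS σ) (⇑ᶜ γ) suc t) (sym (renT-mapT suc σ γ t))

module _ {L₁ L₂ L₃ : Language} (μ : SymbolMap L₂ L₃) (ν : SymbolMap L₁ L₂) where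
  mapT-mapT  : ∀ {n m p} (σ : Fin m → Term L₃ p) (γ : Const L₂ → Term L₃ p)
               (τ : Fin n → Term L₂ m) (δ : Const L₁ → Term L₂ m) (t : Term L₁ n) →
               mapT μ σ γ (mapT ν τ δ t) ≡
               mapT (μ ∘ˢ ν) (λ i → mapT μ σ γ (τ i)) (λ c → mapT μ σ γ (δ c)) t
  mapTs-mapTs : ∀ {n m p k} (σ : Fin m → Term L₃ p) (γ : Const L₂ → Term L₃ p)
                (τ : Fin n → Term L₂ m) (δ : Const L₁ → Term L₂ m) (ts : Vec (Term L₁ n) k) →
                mapTs μ σ γ (mapTs ν τ δ ts) ≡
                mapTs (μ ∘ˢ ν) (λ i → mapT μ σ γ (τ i)) (λ c → mapT μ σ γ (δ c)) ts
  mapT-mapT σ γ τ δ (var i)    = refl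
  mapT-mapT σ γ τ δ (const c)  = refl
  mapT-mapT σ γ τ δ (app f ts) = cong (app (onFun μ (onFun ν f))) (mapTs-mapTs σ γ τ δ ts)
  mapTs-mapTs σ γ τ δ []       = refl
  mapTs-mapTs σ γ τ δ (t ∷ ts) = cong₂ _∷_ (mapT-mapT σ γ τ δ t) (mapTs-mapTs σ γ τ δ ts)

  mapF-mapF : ∀ {n m p} (σ : Fin m → Term L₃ p) (γ : Const L₂ → Term L₃ p)
              (τ : Fin n → Term L₂ m) (δ : Const L₁ → Term L₂ m) (φ : Formula L₁ n) →
              mapF μ σ γ (mapF ν τ δ φ) ≡
              mapF (μ ∘ˢ ν) (λ i → mapT μ σ γ (τ i)) (λ c → mapT μ σ γ (δ c)) φ
  mapF-mapF-bound : ∀ {n m p} (σ : Fin m → Term L₃ p) (γ : Const L₂ → Term L₃ p)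
                    (τ : Fin n → Term L₂ m) (δ : Const L₁ → Term L₂ m) (φ : Formula L₁ (suc n)) →
                    mapF μ (extS σ) (⇑ᶜ γ) (mapF ν (extS τ) (⇑ᶜ δ) φ) ≡
                    mapF (μ ∘ˢ ν) (extS (λ i → mapT μ σ γ (τ i))) (⇑ᶜ (λ c → mapT μ σ γ (δ c))) φ
  mapF-mapF σ γ τ δ (atom P ts) = cong (atom (onPred μ (onPred ν P))) (mapTs-mapTs σ γ τ δ ts)
  mapF-mapF σ γ τ δ (rc r)      = refl
  mapF-mapF σ γ τ δ (φ ∧̇ ψ)     = cong₂ _∧̇_ (mapF-mapF σ γ τ δ φ) (mapF-mapF σ γ τ δ ψ)
  mapF-mapF σ γ τ δ (φ ⇒ ψ)     = cong₂ _⇒_ (mapF-mapF σ γ τ δ φ) (mapF-mapF σ γ τ δ ψ)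
  mapF-mapF σ γ τ δ (∀̇ φ)       = cong ∀̇ (mapF-mapF-bound σ γ τ δ φ)
  mapF-mapF σ γ τ δ (∃̇ φ)       = cong ∃̇ (mapF-mapF-bound σ γ τ δ φ)
  mapF-mapF-bound σ γ τ δ φ =
    trans (mapF-mapF (extS σ) (⇑ᶜ γ) (extS τ) (⇑ᶜ δ) φ)
          (mapF-cong (μ ∘ˢ ν) extS-mapT (λ c → mapT-weaken μ σ γ (δ c)) φ)
    where
    extS-mapT : ∀ i → mapT μ (extS σ) (⇑ᶜ γ) (extS τ i) ≡ extS (λ j → mapT μ σ γ (τ j)) i
    extS-mapT zero    = refl
    extS-mapT (suc i) = mapT-weaken μ σ γ (τ i)

module _ {L : Language} where
  mapT-id  : ∀ {n} (t : Term L n) → mapT idˢ var const t ≡ t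
  mapTs-id : ∀ {n k} (ts : Vec (Term L n) k) → mapTs idˢ var const ts ≡ ts
  mapT-id (var i)    = refl
  mapT-id (const c)  = refl
  mapT-id (app f ts) = cong (app f) (mapTs-id ts)
  mapTs-id []       = refl
  mapTs-id (t ∷ ts) = cong₂ _∷_ (mapT-id t) (mapTs-id ts)

  extS-var : ∀ {n} (i : Fin (suc n)) → extS {L = L} var i ≡ var i
  extS-var zero    = refl
  extS-var (suc i) = refl

  mapF-id : ∀ {n} (φ : Formula L n) → mapF idˢ var const φ ≡ φ
  mapF-id (atom P ts) = cong (atom P) (mapTs-id ts)
  mapF-id (rc r)      = refl
  mapF-id (φ ∧̇ ψ)     = cong₂ _∧̇_ (mapF-id φ) (mapF-id ψ)
  mapF-id (φ ⇒ ψ)     = cong₂ _⇒_ (mapF-id φ) (mapF-id ψ)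
  mapF-id (∀̇ φ)       = cong ∀̇ (trans (mapF-cong idˢ extS-var (λ _ → refl) φ) (mapF-id φ))
  mapF-id (∃̇ φ)       = cong ∃̇ (trans (mapF-cong idˢ extS-var (λ _ → refl) φ) (mapF-id φ))

  renT-as-mapT  : ∀ {n m} (ρ : Fin n → Fin m) (t : Term L n) →
                  renT ρ t ≡ mapT idˢ (λ i → var (ρ i)) const t
  renTs-as-mapTs : ∀ {n m k} (ρ : Fin n → Fin m) (ts : Vec (Term L n) k) →
                   renTs ρ ts ≡ mapTs idˢ (λ i → var (ρ i)) const ts
  renT-as-mapT ρ (var i)    = refl
  renT-as-mapT ρ (const c)  = refl
  renT-as-mapT ρ (app f ts) = cong (app f) (renTs-as-mapTs ρ ts)
  renTs-as-mapTs ρ []       = refl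
  renTs-as-mapTs ρ (t ∷ ts) = cong₂ _∷_ (renT-as-mapT ρ t) (renTs-as-mapTs ρ ts)

  extS-extR : ∀ {n m} (ρ : Fin n → Fin m) (i : Fin (suc n)) →
              var {L = L} (extR {L = L} ρ i) ≡ extS (λ j → var (ρ j)) i
  extS-extR ρ zero    = refl
  extS-extR ρ (suc i) = refl

  renF-as-mapF : ∀ {n m} (ρ : Fin n → Fin m) (φ : Formula L n) →
                 renF ρ φ ≡ mapF idˢ (λ i → var (ρ i)) const φ
  renF-as-mapF ρ (atom P ts) = cong (atom P) (renTs-as-mapTs ρ ts)
  renF-as-mapF ρ (rc r)      = refl
  renF-as-mapF ρ (φ ∧̇ ψ)     = cong₂ _∧̇_ (renF-as-mapF ρ φ) (renF-as-mapF ρ ψ)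
  renF-as-mapF ρ (φ ⇒ ψ)     = cong₂ _⇒_ (renF-as-mapF ρ φ) (renF-as-mapF ρ ψ)
  renF-as-mapF ρ (∀̇ φ)       =
    cong ∀̇ (trans (renF-as-mapF (extR {L = L} ρ) φ) (mapF-cong idˢ (extS-extR ρ) (λ _ → refl) φ))
  renF-as-mapF ρ (∃̇ φ)       =
    cong ∃̇ (trans (renF-as-mapF (extR {L = L} ρ) φ) (mapF-cong idˢ (extS-extR ρ) (λ _ → refl) φ))

  subTs-as-mapTs : ∀ {n m k} (σ : Fin n → Term L m) (ts : Vec (Term L n) k) →
                   subTs σ ts ≡ mapTs idˢ σ const ts
  subTs-as-mapTs σ []             = refl
  subTs-as-mapTs σ (var i ∷ ts)    = cong (σ i ∷_) (subTs-as-mapTs σ ts)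
  subTs-as-mapTs σ (const c ∷ ts)  = cong (const c ∷_) (subTs-as-mapTs σ ts)
  subTs-as-mapTs σ (app f us ∷ ts) =
    cong₂ (λ us′ ts′ → app f us′ ∷ ts′) (subTs-as-mapTs σ us) (subTs-as-mapTs σ ts)

  subF-as-mapF : ∀ {n m} (σ : Fin n → Term L m) (φ : Formula L n) → subF σ φ ≡ mapF idˢ σ const φ
  subF-as-mapF σ (atom P ts) = cong (atom P) (subTs-as-mapTs σ ts)
  subF-as-mapF σ (rc r)      = refl
  subF-as-mapF σ (φ ∧̇ ψ)     = cong₂ _∧̇_ (subF-as-mapF σ φ) (subF-as-mapF σ ψ)
  subF-as-mapF σ (φ ⇒ ψ)     = cong₂ _⇒_ (subF-as-mapF σ φ) (subF-as-mapF σ ψ)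
  subF-as-mapF σ (∀̇ φ)       = cong ∀̇ (subF-as-mapF (extS σ) φ)
  subF-as-mapF σ (∃̇ φ)       = cong ∃̇ (subF-as-mapF (extS σ) φ)

module _ {L L′ : Language} (μ : SymbolMap L L′) where
  mapF-renF : ∀ {n n′ m} (σ : Fin n′ → Term L′ m) (γ : Const L → Term L′ m)
              (ρ : Fin n → Fin n′) (φ : Formula L n) →
              mapF μ σ γ (renF ρ φ) ≡ mapF μ (λ i → σ (ρ i)) γ φ
  mapF-renF σ γ ρ φ = trans (cong (mapF μ σ γ) (renF-as-mapF ρ φ)) (mapF-mapF μ idˢ σ γ _ const φ)

  renF-mapF : ∀ {n m m′} (ρ : Fin m → Fin m′) (σ : Fin n → Term L′ m) (γ : Const L → Term L′ m)
              (φ : Formula L n) →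
              renF ρ (mapF μ σ γ φ) ≡ mapF μ (λ i → renT ρ (σ i)) (λ c → renT ρ (γ c)) φ
  renF-mapF ρ σ γ φ =
    trans (renF-as-mapF ρ (mapF μ σ γ φ))
      (trans (mapF-mapF idˢ μ _ const σ γ φ)
             (sym (mapF-cong μ (λ i → renT-as-mapT ρ (σ i)) (λ c → renT-as-mapT ρ (γ c)) φ)))

module _ {L L̂ : Language} (ι : L ⊑ L̂) where
  symbolsOf : SymbolMap L L̂
  symbolsOf = record { onPred = predᵉ ι ; onFun = funᵉ ι }

  trTs-as-mapTs : ∀ {n k} (ts : Vec (Term L n) k) →
                  trTs ι ts ≡ mapTs symbolsOf var (λ c → const (constᵉ ι c)) ts
  trTs-as-mapTs []              = refl
  trTs-as-mapTs (var i ∷ ts)    = cong (var i ∷_) (trTs-as-mapTs ts)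
  trTs-as-mapTs (const c ∷ ts)  = cong (const (constᵉ ι c) ∷_) (trTs-as-mapTs ts)
  trTs-as-mapTs (app f us ∷ ts) =
    cong₂ (λ us′ ts′ → app (funᵉ ι f) us′ ∷ ts′) (trTs-as-mapTs us) (trTs-as-mapTs ts)

  trF-as-mapF : ∀ {n} (φ : Formula L n) → trF ι φ ≡ mapF symbolsOf var (λ c → const (constᵉ ι c)) φ
  trF-as-mapF (atom P ts) = cong (atom (predᵉ ι P)) (trTs-as-mapTs ts)
  trF-as-mapF (rc r)      = refl
  trF-as-mapF (φ ∧̇ ψ)     = cong₂ _∧̇_ (trF-as-mapF φ) (trF-as-mapF ψ)
  trF-as-mapF (φ ⇒ ψ)     = cong₂ _⇒_ (trF-as-mapF φ) (trF-as-mapF ψ)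
  trF-as-mapF (∀̇ φ)       =
    cong ∀̇ (trans (trF-as-mapF φ) (mapF-cong symbolsOf (λ i → sym (extS-var i)) (λ _ → refl) φ))
  trF-as-mapF (∃̇ φ)       =
    cong ∃̇ (trans (trF-as-mapF φ) (mapF-cong symbolsOf (λ i → sym (extS-var i)) (λ _ → refl) φ))

module HilbertCalculus {L : Language} {T : Theory L} {n : ℕ} where
  private
    F = Formula L n

  ⇔-elimˡ : {A B : F} → T ⊢ A ⇔ B → T ⊢ A ⇒ B
  ⇔-elimˡ {A} {B} d = mp d (ax (G2 (A ⇒ B) (B ⇒ A)))

  ⇔-elimʳ : {A B : F} → T ⊢ A ⇔ B → T ⊢ B ⇒ A
  ⇔-elimʳ {A} {B} d = mp (mp d (ax (G3 (A ⇒ B) (B ⇒ A)))) (ax (G2 (B ⇒ A) (A ⇒ B)))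

  ⇒-trans : {A B C : F} → T ⊢ A ⇒ B → T ⊢ B ⇒ C → T ⊢ A ⇒ C
  ⇒-trans {A} {B} {C} p q = mp q (mp p (ax (G1 A B C)))

  ⇒-curry : {A B C : F} → T ⊢ (A ∧̇ B) ⇒ C → T ⊢ A ⇒ (B ⇒ C)
  ⇒-curry {A} {B} {C} d = mp d (⇔-elimʳ (ax (G5 A B C)))

  ⇒-uncurry : {A B C : F} → T ⊢ A ⇒ (B ⇒ C) → T ⊢ (A ∧̇ B) ⇒ C
  ⇒-uncurry {A} {B} {C} d = mp d (⇔-elimˡ (ax (G5 A B C)))

  ⇒-const : {A B : F} → T ⊢ A ⇒ (B ⇒ A)
  ⇒-const {A} {B} = ⇒-curry (ax (G2 A B))

  ⇒-weaken : {A B : F} → T ⊢ A → T ⊢ B ⇒ A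
  ⇒-weaken d = mp d ⇒-const

  ⇒-refl : {A : F} → T ⊢ A ⇒ A
  ⇒-refl {A} = ⇒-trans (ax (G4 A)) (ax (G2 A A))

  ⇒-contract : {A C : F} → T ⊢ A ⇒ (A ⇒ C) → T ⊢ A ⇒ C
  ⇒-contract {A} d = ⇒-trans (ax (G4 A)) (⇒-uncurry d)

  ⇒-mp : {X B C : F} → T ⊢ X ⇒ B → T ⊢ X ⇒ (B ⇒ C) → T ⊢ X ⇒ C
  ⇒-mp {X} {B} {C} p q = ⇒-contract (⇒-trans q (mp p (ax (G1 X B C))))

  ⇒-post : {X P Q R : F} → T ⊢ X ⇒ (P ⇒ Q) → T ⊢ Q ⇒ R → T ⊢ X ⇒ (P ⇒ R)
  ⇒-post {X} {P} {Q} {R} d qr = ⇒-trans d (⇒-mp (⇒-weaken qr) (ax (G1 P Q R)))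

  ⇒-apply : {A B : F} → T ⊢ A ⇒ ((A ⇒ B) ⇒ B)
  ⇒-apply {A} {B} =
    ⇒-curry (⇒-mp (ax (G2 A (A ⇒ B))) (⇒-trans (ax (G3 A (A ⇒ B))) (ax (G2 (A ⇒ B) A))))

  ∧-intro : {X A B : F} → T ⊢ X ⇒ A → T ⊢ X ⇒ B → T ⊢ X ⇒ (A ∧̇ B)
  ∧-intro p q = ⇒-mp q (⇒-trans p (⇒-curry ⇒-refl))

  ∨-introˡ : {A B : F} → T ⊢ A ⇒ (A ∨̇ B)
  ∨-introˡ = ∧-intro ⇒-apply ⇒-const

  ∨-introʳ : {A B : F} → T ⊢ B ⇒ (A ∨̇ B)
  ∨-introʳ = ∧-intro ⇒-const ⇒-apply

  ∨-elim : {A B C : F} → T ⊢ A ⇒ C → T ⊢ B ⇒ C → T ⊢ (A ∨̇ B) ⇒ C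
  ∨-elim {A} {B} {C} ac bc =
    ⇒-mp (⇒-post (⇒-trans (ax (G3 ((A ⇒ B) ⇒ B) ((B ⇒ A) ⇒ A)))
                          (ax (G2 ((B ⇒ A) ⇒ A) ((A ⇒ B) ⇒ B)))) ac)
         (⇒-trans (⇒-post (ax (G2 ((A ⇒ B) ⇒ B) ((B ⇒ A) ⇒ A))) bc) (ax (G6 A B C)))

  prelinearity : {A B : F} → T ⊢ (A ⇒ B) ∨̇ (B ⇒ A)
  prelinearity {A} {B} = mp ∨-introʳ (mp ∨-introˡ (ax (G6 A B ((A ⇒ B) ∨̇ (B ⇒ A)))))

open HilbertCalculus

module _ {L : Language} where
  ⊢-mono : ∀ {T T′ : Theory L} {n} {φ : Formula L n} → T ⊆ᵀ T′ → T ⊢ φ → T′ ⊢ φ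
  ⊢-mono T⊆T′ (ax a)   = ax a
  ⊢-mono T⊆T′ (hyp h)  = hyp (T⊆T′ _ h)
  ⊢-mono T⊆T′ (mp d e) = mp (⊢-mono T⊆T′ d) (⊢-mono T⊆T′ e)
  ⊢-mono T⊆T′ (gen d)  = gen (⊢-mono T⊆T′ d)

  infixl 25 _∪｛_｝
  _∪｛_｝ : Theory L → Sentence L → Theory L
  (T ∪｛ ψ ｝) χ = T χ ⊎ (χ ≡ ψ)

  mapF-sentence : ∀ {m} (σ : Fin 0 → Term L m) (χ : Sentence L) → mapF idˢ σ const χ ≡ emb χ
  mapF-sentence σ χ = trans (mapF-cong idˢ (λ ()) (λ _ → refl) χ) (sym (renF-as-mapF _ χ))

  wk-emb : ∀ {n} (χ : Sentence L) → wk (emb {n = n} χ) ≡ emb χ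
  wk-emb χ = trans (cong wk (renF-as-mapF _ χ))
                   (trans (renF-mapF idˢ suc _ const χ) (mapF-sentence _ χ))

  emb-sentence : (χ : Sentence L) → emb χ ≡ χ
  emb-sentence χ = trans (sym (mapF-sentence var χ)) (mapF-id χ)

  deduction : ∀ {T : Theory L} {χ : Sentence L} {n} {ψ : Formula L n} →
              T ∪｛ χ ｝ ⊢ ψ → T ⊢ emb χ ⇒ ψ
  deduction (ax a)            = ⇒-weaken (ax a)
  deduction (hyp (inj₁ h))    = ⇒-weaken (hyp h)
  deduction (hyp (inj₂ refl)) = ⇒-refl
  deduction (mp d e)          = ⇒-mp (deduction d) (deduction e)
  deduction {T} {χ} (gen {φ = φ} d) =
    mp (gen (subst (λ θ → T ⊢ θ ⇒ φ) (sym (wk-emb χ)) (deduction d))) (ax (G∀2 (emb χ) φ))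

  deduction₀ : ∀ {T : Theory L} {χ ψ : Sentence L} → T ∪｛ χ ｝ ⊢ ψ → T ⊢ χ ⇒ ψ
  deduction₀ {T} {χ} {ψ} d = subst (λ θ → T ⊢ θ ⇒ ψ) (emb-sentence χ) (deduction d)

  hyp₀ : ∀ {T : Theory L} {χ : Sentence L} → T χ → T ⊢ χ
  hyp₀ {T} {χ} h = subst (T ⊢_) (emb-sentence χ) (hyp h)

mapT-instantiate-weaken : ∀ {L k} {s : Fin (suc k) → Term L k} → (∀ j → s (suc j) ≡ var j) →
                          ∀ (u : Term L k) → mapT idˢ s const (renT suc u) ≡ u
mapT-instantiate-weaken {s = s} s∘suc≡var u =
  trans (mapT-renT idˢ s const suc u) (trans (mapT-cong idˢ s∘suc≡var (λ _ → refl) u) (mapT-id u))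

module _ {L L′ : Language} (μ : SymbolMap L L′) where
  mapF-wk : ∀ {n m} (σ : Fin n → Term L′ m) (γ : Const L → Term L′ m) (ψ : Formula L n) →
            mapF μ (extS σ) (⇑ᶜ γ) (wk ψ) ≡ wk (mapF μ σ γ ψ)
  mapF-wk σ γ ψ = trans (mapF-renF μ (extS σ) (⇑ᶜ γ) suc ψ) (sym (renF-mapF μ suc σ γ ψ))

  mapF-[] : ∀ {n m} (σ : Fin n → Term L′ m) (γ : Const L → Term L′ m)
            (φ : Formula L (suc n)) (t : Term L n) →
            mapF μ σ γ (φ [ t ]) ≡ mapF μ (extS σ) (⇑ᶜ γ) φ [ mapT μ σ γ t ]
  mapF-[] σ γ φ t =
    trans (cong (mapF μ σ γ) (subF-as-mapF _ φ))
     (trans (mapF-mapF μ idˢ σ γ _ const φ)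
      (trans (mapF-cong μ (λ { zero → refl ; (suc i) → sym (mapT-instantiate-weaken (λ _ → refl) (σ i)) })
                          (λ c → sym (mapT-instantiate-weaken (λ _ → refl) (γ c))) φ)
       (sym (trans (subF-as-mapF _ (mapF μ (extS σ) (⇑ᶜ γ) φ))
                   (mapF-mapF idˢ μ _ const (extS σ) (⇑ᶜ γ) φ)))))

  axiom-mapF : ∀ {n m} (σ : Fin n → Term L′ m) (γ : Const L → Term L′ m) {ψ : Formula L n} →
               Axiom ψ → Axiom (mapF μ σ γ ψ)
  axiom-mapF σ γ (G1 φ ψ χ)     = G1 _ _ _
  axiom-mapF σ γ (G2 φ ψ)       = G2 _ _
  axiom-mapF σ γ (G3 φ ψ)       = G3 _ _
  axiom-mapF σ γ (G4 φ)         = G4 _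
  axiom-mapF σ γ (G5 φ ψ χ)     = G5 _ _ _
  axiom-mapF σ γ (G6 φ ψ χ)     = G6 _ _ _
  axiom-mapF σ γ (G7 φ)         = G7 _
  axiom-mapF σ γ (G∀1 φ t)      =
    subst (λ θ → Axiom (∀̇ φ′ ⇒ θ)) (sym (mapF-[] σ γ φ t)) (G∀1 _ _)
    where φ′ = mapF μ (extS σ) (⇑ᶜ γ) φ
  axiom-mapF σ γ (G∀2 ψ φ)      =
    subst (λ θ → Axiom (∀̇ (θ ⇒ φ′) ⇒ (mapF μ σ γ ψ ⇒ ∀̇ φ′))) (sym (mapF-wk σ γ ψ)) (G∀2 _ _)
    where φ′ = mapF μ (extS σ) (⇑ᶜ γ) φ
  axiom-mapF σ γ (G∀3 ψ φ)      =
    subst (λ θ → Axiom (∀̇ (θ ∨̇ φ′) ⇒ (mapF μ σ γ ψ ∨̇ ∀̇ φ′))) (sym (mapF-wk σ γ ψ)) (G∀3 _ _)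
    where φ′ = mapF μ (extS σ) (⇑ᶜ γ) φ
  axiom-mapF σ γ (G∃1 φ t)      =
    subst (λ θ → Axiom (θ ⇒ ∃̇ φ′)) (sym (mapF-[] σ γ φ t)) (G∃1 _ _)
    where φ′ = mapF μ (extS σ) (⇑ᶜ γ) φ
  axiom-mapF σ γ (G∃2 ψ φ)      =
    subst (λ θ → Axiom (∃̇ (θ ⇒ φ′) ⇒ (mapF μ σ γ ψ ⇒ ∃̇ φ′))) (sym (mapF-wk σ γ ψ)) (G∃2 _ _)
    where φ′ = mapF μ (extS σ) (⇑ᶜ γ) φ
  axiom-mapF σ γ (RGL1 r s)     = RGL1 r s
  axiom-mapF σ γ (RGL2≥ r s p)  = RGL2≥ r s p
  axiom-mapF σ γ (RGL2< r s p)  = RGL2< r s p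
  axiom-mapF σ γ (RGL3 r p)     = RGL3 r p

  module _ {T : Theory L} {T′ : Theory L′}
           (Admissible : ∀ {m} → (Const L → Term L′ m) → Set)
           (admissible-⇑ᶜ : ∀ {m} {γ : Const L → Term L′ m} → Admissible γ → Admissible (⇑ᶜ γ))
           (admissible-hyp : ∀ {m} {γ : Const L → Term L′ m} {χ} →
                             Admissible γ → T χ → T′ ⊢ mapF μ (λ ()) γ χ) where
    ⊢-mapF : ∀ {n m} (σ : Fin n → Term L′ m) (γ : Const L → Term L′ m) →
             Admissible γ → {ψ : Formula L n} → T ⊢ ψ → T′ ⊢ mapF μ σ γ ψ
    ⊢-mapF σ γ γ-ok (ax a)            = ax (axiom-mapF σ γ a)
    ⊢-mapF σ γ γ-ok (hyp {φ = χ} h)   =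
      subst (T′ ⊢_) (sym (trans (mapF-renF μ σ γ _ χ) (mapF-cong μ (λ ()) (λ _ → refl) χ)))
            (admissible-hyp γ-ok h)
    ⊢-mapF σ γ γ-ok (mp d e)          = mp (⊢-mapF σ γ γ-ok d) (⊢-mapF σ γ γ-ok e)
    ⊢-mapF σ γ γ-ok (gen d)           = gen (⊢-mapF (extS σ) (⇑ᶜ γ) (admissible-⇑ᶜ γ-ok) d)

-- Coding sentences by natural numbers

triangle : ℕ → ℕ
triangle zero    = zero
triangle (suc n) = suc n + triangle n

triangle-mono : ∀ {m n} → m ≤ℕ n → triangle m ≤ℕ triangle n
triangle-mono z≤n     = z≤n
triangle-mono (s≤s p) = ℕ.+-mono-≤ (s≤s p) (triangle-mono p)

-- Every point of the diagonal a + b = s lies below every point of a later diagonal.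
diagonal-< : ∀ {a s s′} c → a ≤ℕ s → s <ℕ s′ → a + triangle s <ℕ c + triangle s′
diagonal-< {a} {s} {s′} c a≤s s<s′ =
  ℕ.≤-trans (s≤s (ℕ.+-monoˡ-≤ (triangle s) a≤s)) (ℕ.≤-trans (triangle-mono s<s′) (ℕ.m≤n+m _ c))

opaque
  pair : ℕ → ℕ → ℕ
  pair a b = a + triangle (a + b)

  pair-injective : ∀ {a b c d} → pair a b ≡ pair c d → a ≡ c × b ≡ d
  pair-injective {a} {b} {c} {d} e with ℕ.<-cmp (a + b) (c + d)
  ... | tri< s<s′ _ _ = ⊥-elim (ℕ.<-irrefl e (diagonal-< c (ℕ.m≤m+n a b) s<s′))
  ... | tri> _ _ s>s′ = ⊥-elim (ℕ.<-irrefl (sym e) (diagonal-< a (ℕ.m≤m+n c d) s>s′))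
  ... | tri≈ _ s≡s′ _ = a≡c , ℕ.+-cancelˡ-≡ c b d (trans (cong (_+ b) (sym a≡c)) s≡s′)
    where
    a≡c : a ≡ c
    a≡c = ℕ.+-cancelʳ-≡ (triangle (a + b)) a c (trans e (cong (λ s → c + triangle s) (sym s≡s′)))

pair-injectiveˡ : ∀ {a b c d} → pair a b ≡ pair c d → a ≡ c
pair-injectiveˡ e = proj₁ (pair-injective e)

pair-injectiveʳ : ∀ {a b c d} → pair a b ≡ pair c d → b ≡ d
pair-injectiveʳ e = proj₂ (pair-injective e)

countable-⊎ : ∀ {A B : Set} → Countable A → Countable B → Countable (A ⊎ B)
countable-⊎ {A} {B} (f , f-inj) (g , g-inj) = code , code-inj
  where
  code : A ⊎ B → ℕ
  code (inj₁ a) = pair 0 (f a)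
  code (inj₂ b) = pair 1 (g b)
  code-inj : ∀ {x y} → code x ≡ code y → x ≡ y
  code-inj {inj₁ _} {inj₁ _} e = cong inj₁ (f-inj (pair-injectiveʳ e))
  code-inj {inj₂ _} {inj₂ _} e = cong inj₂ (g-inj (pair-injectiveʳ e))
  code-inj {inj₁ _} {inj₂ _} e with () ← pair-injectiveˡ e
  code-inj {inj₂ _} {inj₁ _} e with () ← pair-injectiveˡ e

countable-ℕ : Countable ℕ
countable-ℕ = (λ n → n) , (λ e → e)

countable-ℤ : Countable ℤ
countable-ℤ = code , code-inj
  where
  code : ℤ → ℕ
  code (+ n)    = pair 0 n
  code -[1+ n ] = pair 1 n
  code-inj : ∀ {x y} → code x ≡ code y → x ≡ y
  code-inj {+ _}      {+ _}      e = cong +_ (pair-injectiveʳ e)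
  code-inj { -[1+ _ ]} { -[1+ _ ]} e = cong -[1+_] (pair-injectiveʳ e)
  code-inj {+ _}      { -[1+ _ ]} e with () ← pair-injectiveˡ e
  code-inj { -[1+ _ ]} {+ _}      e with () ← pair-injectiveˡ e

countable-ℚ : Countable ℚ
countable-ℚ = code , code-inj
  where
  code : ℚ → ℕ
  code (mkℚ n d _) = pair (proj₁ countable-ℤ n) d
  code-inj : ∀ {x y} → code x ≡ code y → x ≡ y
  code-inj {mkℚ n _ _} {mkℚ n′ _ _} e with proj₂ countable-ℤ {n} {n′} (pair-injectiveˡ e)
                                         | pair-injectiveʳ e
  ... | refl | refl = refl

countable-ℚ01 : Countable ℚ01
countable-ℚ01 = code , code-inj
  where
  code : ℚ01 → ℕ
  code r = proj₁ countable-ℚ (val r)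
  code-inj : ∀ {r s} → code r ≡ code s → r ≡ s
  code-inj {⟨ v , lo , hi ⟩} {⟨ v′ , lo′ , hi′ ⟩} e
    with proj₂ countable-ℚ {v} {v′} e
  ... | refl with ℚ.≤-irrelevant lo lo′ | ℚ.≤-irrelevant hi hi′
  ...   | refl | refl = refl

module FormulaCoding (M : Language) where
  private
    codeP : ∀ {k} → Pred M k → ℕ
    codeP {k} = proj₁ (Pred-countable M k)
    codeFun : ∀ {k} → Fun M k → ℕ
    codeFun {k} = proj₁ (Fun-countable M k)

  codeT  : ∀ {n} → Term M n → ℕ
  codeTs : ∀ {n k} → Vec (Term M n) k → ℕ
  codeT (var i)          = pair 0 (toℕ i)
  codeT (const c)        = pair 1 (proj₁ (Const-countable M) c)
  codeT (app {k} f ts)   = pair 2 (pair k (pair (codeFun f) (codeTs ts)))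
  codeTs []       = 0
  codeTs (t ∷ ts) = suc (pair (codeT t) (codeTs ts))

  codeF : ∀ {n} → Formula M n → ℕ
  codeF (atom {k} P ts) = pair 0 (pair k (pair (codeP P) (codeTs ts)))
  codeF (rc r)          = pair 1 (proj₁ countable-ℚ01 r)
  codeF (φ ∧̇ ψ)         = pair 2 (pair (codeF φ) (codeF ψ))
  codeF (φ ⇒ ψ)         = pair 3 (pair (codeF φ) (codeF ψ))
  codeF (∀̇ φ)           = pair 4 (codeF φ)
  codeF (∃̇ φ)           = pair 5 (codeF φ)

  codeT-injective  : ∀ {n} {t u : Term M n} → codeT t ≡ codeT u → t ≡ u
  codeTs-injective : ∀ {n k} {ts us : Vec (Term M n) k} → codeTs ts ≡ codeTs us → ts ≡ us
  codeT-injective {t = var i}   {var j}   e = cong var (toℕ-injective (pair-injectiveʳ e))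
  codeT-injective {t = const c} {const d} e = cong const (proj₂ (Const-countable M) (pair-injectiveʳ e))
  codeT-injective {t = app {k} f ts} {app g us} e
    with refl , e′ ← pair-injective (pair-injectiveʳ e)
    with proj₂ (Fun-countable M k) (pair-injectiveˡ e′) | codeTs-injective {ts = ts} {us} (pair-injectiveʳ e′)
  ... | refl | refl = refl
  codeT-injective {t = var _}   {const _} e with () ← pair-injectiveˡ e
  codeT-injective {t = var _}   {app _ _} e with () ← pair-injectiveˡ e
  codeT-injective {t = const _} {var _}   e with () ← pair-injectiveˡ e
  codeT-injective {t = const _} {app _ _} e with () ← pair-injectiveˡ e
  codeT-injective {t = app _ _} {var _}   e with () ← pair-injectiveˡ e
  codeT-injective {t = app _ _} {const _} e with () ← pair-injectiveˡ e
  codeTs-injective {ts = []}     {[]}     e = refl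
  codeTs-injective {ts = t ∷ ts} {u ∷ us} e =
    cong₂ _∷_ (codeT-injective (pair-injectiveˡ e′)) (codeTs-injective (pair-injectiveʳ e′))
    where e′ = ℕ.suc-injective e

  codeF-injective : ∀ {n} {φ ψ : Formula M n} → codeF φ ≡ codeF ψ → φ ≡ ψ
  codeF-injective {φ = atom {k} P ts} {atom Q us} e
    with refl , e′ ← pair-injective (pair-injectiveʳ e)
    with proj₂ (Pred-countable M k) (pair-injectiveˡ e′) | codeTs-injective {ts = ts} {us} (pair-injectiveʳ e′)
  ... | refl | refl = refl
  codeF-injective {φ = rc r}    {rc s}    e = cong rc (proj₂ countable-ℚ01 (pair-injectiveʳ e))
  codeF-injective {φ = φ ∧̇ φ′}  {ψ ∧̇ ψ′}  e =
    cong₂ _∧̇_ (codeF-injective (pair-injectiveˡ e′)) (codeF-injective (pair-injectiveʳ e′))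
    where e′ = pair-injectiveʳ e
  codeF-injective {φ = φ ⇒ φ′}  {ψ ⇒ ψ′}  e =
    cong₂ _⇒_ (codeF-injective (pair-injectiveˡ e′)) (codeF-injective (pair-injectiveʳ e′))
    where e′ = pair-injectiveʳ e
  codeF-injective {φ = ∀̇ φ}     {∀̇ ψ}     e = cong ∀̇ (codeF-injective (pair-injectiveʳ e))
  codeF-injective {φ = ∃̇ φ}     {∃̇ ψ}     e = cong ∃̇ (codeF-injective (pair-injectiveʳ e))
  codeF-injective {φ = atom _ _} {rc _}    e with () ← pair-injectiveˡ e
  codeF-injective {φ = atom _ _} {_ ∧̇ _}   e with () ← pair-injectiveˡ e
  codeF-injective {φ = atom _ _} {_ ⇒ _}   e with () ← pair-injectiveˡ e
  codeF-injective {φ = atom _ _} {∀̇ _}     e with () ← pair-injectiveˡ e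
  codeF-injective {φ = atom _ _} {∃̇ _}     e with () ← pair-injectiveˡ e
  codeF-injective {φ = rc _}     {atom _ _} e with () ← pair-injectiveˡ e
  codeF-injective {φ = rc _}     {_ ∧̇ _}   e with () ← pair-injectiveˡ e
  codeF-injective {φ = rc _}     {_ ⇒ _}   e with () ← pair-injectiveˡ e
  codeF-injective {φ = rc _}     {∀̇ _}     e with () ← pair-injectiveˡ e
  codeF-injective {φ = rc _}     {∃̇ _}     e with () ← pair-injectiveˡ e
  codeF-injective {φ = _ ∧̇ _}    {atom _ _} e with () ← pair-injectiveˡ e
  codeF-injective {φ = _ ∧̇ _}    {rc _}    e with () ← pair-injectiveˡ e
  codeF-injective {φ = _ ∧̇ _}    {_ ⇒ _}   e with () ← pair-injectiveˡ e
  codeF-injective {φ = _ ∧̇ _}    {∀̇ _}     e with () ← pair-injectiveˡ e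
  codeF-injective {φ = _ ∧̇ _}    {∃̇ _}     e with () ← pair-injectiveˡ e
  codeF-injective {φ = _ ⇒ _}    {atom _ _} e with () ← pair-injectiveˡ e
  codeF-injective {φ = _ ⇒ _}    {rc _}    e with () ← pair-injectiveˡ e
  codeF-injective {φ = _ ⇒ _}    {_ ∧̇ _}   e with () ← pair-injectiveˡ e
  codeF-injective {φ = _ ⇒ _}    {∀̇ _}     e with () ← pair-injectiveˡ e
  codeF-injective {φ = _ ⇒ _}    {∃̇ _}     e with () ← pair-injectiveˡ e
  codeF-injective {φ = ∀̇ _}      {atom _ _} e with () ← pair-injectiveˡ e
  codeF-injective {φ = ∀̇ _}      {rc _}    e with () ← pair-injectiveˡ e
  codeF-injective {φ = ∀̇ _}      {_ ∧̇ _}   e with () ← pair-injectiveˡ e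
  codeF-injective {φ = ∀̇ _}      {_ ⇒ _}   e with () ← pair-injectiveˡ e
  codeF-injective {φ = ∀̇ _}      {∃̇ _}     e with () ← pair-injectiveˡ e
  codeF-injective {φ = ∃̇ _}      {atom _ _} e with () ← pair-injectiveˡ e
  codeF-injective {φ = ∃̇ _}      {rc _}    e with () ← pair-injectiveˡ e
  codeF-injective {φ = ∃̇ _}      {_ ∧̇ _}   e with () ← pair-injectiveˡ e
  codeF-injective {φ = ∃̇ _}      {_ ⇒ _}   e with () ← pair-injectiveˡ e
  codeF-injective {φ = ∃̇ _}      {∀̇ _}     e with () ← pair-injectiveˡ e

-- Lindenbaum's construction: stage k + 1 looks at the sentence with code k, if there is one.
-- It is added when that keeps the theory strongly consistent; otherwise `reject` may extend
-- the theory in another way (this is where Henkin witnesses enter).  The number b carried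
-- along bounds the fresh constants used so far.
module Lindenbaum
  (lem : ExcludedMiddle 0ℓ) (M : Language) (T₀ : Theory M)
  (height : Sentence M → ℕ)
  (Good : Theory M → ℕ → Set)
  (good₀ : Good T₀ 0)
  (good⇒sc : ∀ {U b} → Good U b → StronglyConsistent U)
  (good-accept : ∀ {U b ψ} → Good U b → StronglyConsistent (U ∪｛ ψ ｝) →
                 Good (U ∪｛ ψ ｝) (b ⊔ height ψ))
  (reject : Theory M → ℕ → Sentence M → Theory M × ℕ)
  (good-reject : ∀ {U b ψ} → Good U b → ¬ StronglyConsistent (U ∪｛ ψ ｝) →
                 Good (proj₁ (reject U b ψ)) (proj₂ (reject U b ψ)))
  (⊆-reject : ∀ {U b ψ} → U ⊆ᵀ proj₁ (reject U b ψ))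
  where

  open FormulaCoding M using (codeF; codeF-injective)

  Coded : ℕ → Set
  Coded k = Σ (Sentence M) λ ψ → codeF ψ ≡ k

  decide : (U : Theory M) (b : ℕ) (ψ : Sentence M) → Dec (StronglyConsistent (U ∪｛ ψ ｝)) →
           Theory M × ℕ
  decide U b ψ (yes _) = U ∪｛ ψ ｝ , b ⊔ height ψ
  decide U b ψ (no _)  = reject U b ψ

  step : (k : ℕ) (U : Theory M) (b : ℕ) → Dec (Coded k) → Theory M × ℕ
  step k U b (yes (ψ , _)) = decide U b ψ lem
  step k U b (no _)        = U , b

  stage : ℕ → Theory M × ℕ
  stage zero    = T₀ , 0
  stage (suc k) = step k (proj₁ (stage k)) (proj₂ (stage k)) lem

  Th : ℕ → Theory M
  Th k = proj₁ (stage k)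

  good-stage : ∀ k → Good (Th k) (proj₂ (stage k))
  good-stage zero    = good₀
  good-stage (suc k) = good-step (good-stage k) lem
    where
    good-decide : ∀ {U b ψ} → Good U b → (d : Dec (StronglyConsistent (U ∪｛ ψ ｝))) →
                  Good (proj₁ (decide U b ψ d)) (proj₂ (decide U b ψ d))
    good-decide g (yes sc) = good-accept g sc
    good-decide g (no ¬sc) = good-reject g ¬sc
    good-step : ∀ {U b} → Good U b → (d : Dec (Coded k)) →
                Good (proj₁ (step k U b d)) (proj₂ (step k U b d))
    good-step g (yes _) = good-decide g lem
    good-step g (no _)  = g

  Th-⊆-suc : ∀ k → Th k ⊆ᵀ Th (suc k)
  Th-⊆-suc k = ⊆-step lem
    where
    ⊆-decide : ∀ {U b ψ} (d : Dec (StronglyConsistent (U ∪｛ ψ ｝))) → U ⊆ᵀ proj₁ (decide U b ψ d)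
    ⊆-decide (yes _) χ h = inj₁ h
    ⊆-decide (no _)      = ⊆-reject
    ⊆-step : ∀ {U b} (d : Dec (Coded k)) → U ⊆ᵀ proj₁ (step k U b d)
    ⊆-step (yes _) = ⊆-decide lem
    ⊆-step (no _) χ h = h

  Th-mono : ∀ {k k′} → k ≤ℕ k′ → Th k ⊆ᵀ Th k′
  Th-mono k≤k′ = mono′ (ℕ.≤⇒≤′ k≤k′)
    where
    mono′ : ∀ {k k′} → k ≤′ k′ → Th k ⊆ᵀ Th k′
    mono′ ≤′-refl        χ h = h
    mono′ (≤′-step k≤k′) χ h = Th-⊆-suc _ χ (mono′ k≤k′ χ h)

  T̂ : Theory M
  T̂ χ = Σ ℕ λ k → Th k χ

  Th-⊆-T̂ : ∀ k → Th k ⊆ᵀ T̂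
  Th-⊆-T̂ k χ h = k , h

  compactness : ∀ {n} {φ : Formula M n} → T̂ ⊢ φ → Σ ℕ λ k → Th k ⊢ φ
  compactness (ax a)        = 0 , ax a
  compactness (hyp (k , h)) = k , hyp h
  compactness (mp d e) with compactness d | compactness e
  ... | k , d′ | k′ , e′ =
    k ⊔ k′ , mp (⊢-mono (Th-mono (m≤m⊔n k k′)) d′) (⊢-mono (Th-mono (m≤n⊔m k k′)) e′)
  compactness (gen d) with compactness d
  ... | k , d′ = k , gen d′

  T̂-sc : StronglyConsistent T̂
  T̂-sc r r>0 d with compactness d
  ... | k , d′ = good⇒sc (good-stage k) r r>0 d′

  Outcome : Theory M → ℕ → Sentence M → Theory M → Set
  Outcome U b χ V =
    StronglyConsistent (U ∪｛ χ ｝) × V χ ⊎ ¬ StronglyConsistent (U ∪｛ χ ｝) × proj₁ (reject U b χ) ⊆ᵀ V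

  Verdict : Sentence M → Set
  Verdict χ = Outcome (Th (codeF χ)) (proj₂ (stage (codeF χ))) χ (Th (suc (codeF χ)))

  verdict : ∀ χ → Verdict χ
  verdict χ = at-stage lem
    where
    k = codeF χ
    b = proj₂ (stage k)
    by-decision : (d : Dec (StronglyConsistent (Th k ∪｛ χ ｝))) → Outcome (Th k) b χ (proj₁ (decide (Th k) b χ d))
    by-decision (yes sc) = inj₁ (sc , inj₂ refl)
    by-decision (no ¬sc) = inj₂ (¬sc , λ θ h → h)
    at-stage : (d : Dec (Coded k)) → Outcome (Th k) b χ (proj₁ (step k (Th k) b d))
    at-stage (no ¬coded) = ⊥-elim (¬coded (χ , refl))
    at-stage (yes (ψ , e)) with refl ← codeF-injective {φ = ψ} {χ} e = by-decision lem

  T̂-maximal : ∀ (T′ : Theory M) → T̂ ⊆ᵀ T′ → StronglyConsistent T′ → T′ ⊆ᵀ T̂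
  T̂-maximal T′ T̂⊆T′ sc′ χ χ∈T′ with verdict χ
  ... | inj₁ (_ , χ∈Th) = Th-⊆-T̂ (suc (codeF χ)) χ χ∈Th
  ... | inj₂ (¬sc , _) = ⊥-elim (¬sc λ r r>0 d → sc′ r r>0 (⊢-mono Th∪χ⊆T′ d))
    where
    Th∪χ⊆T′ : Th (codeF χ) ∪｛ χ ｝ ⊆ᵀ T′
    Th∪χ⊆T′ θ (inj₁ h)    = T̂⊆T′ θ (Th-⊆-T̂ (codeF χ) θ h)
    Th∪χ⊆T′ θ (inj₂ refl) = χ∈T′

  T̂-maximally-sc : MaximallyStronglyConsistent T̂
  T̂-maximally-sc = T̂-sc , T̂-maximal

-- The Henkin completion

dense-below : (r : ℚ01) → 0ℚ < val r → Σ ℚ01 λ s → 0ℚ < val s × val s < val r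
dense-below r r>0 with ℚ.<-dense r>0
... | s , s>0 , s<r = ⟨ s , ℚ.<⇒≤ s>0 , ℚ.≤-trans (ℚ.<⇒≤ s<r) (hi r) ⟩ , s>0 , s<r

-- In RGL* a disjunction of two positive truth constants is as bad as the smaller one.
sc-refutes-∨ : ∀ {L} {U : Theory L} {A B : Sentence L} {q r : ℚ01} → StronglyConsistent U →
               0ℚ < val q → 0ℚ < val r →
               U ⊢ A ∨̇ B → U ⊢ A ⇒ rc q → U ⊢ B ⇒ rc r → ⊥
sc-refutes-∨ {q = q} {r} sc q>0 r>0 A∨B A⇒q B⇒r with ℚ.≤-total (val q) (val r)
... | inj₁ q≤r = sc q q>0 (mp A∨B (∨-elim A⇒q (⇒-trans B⇒r (ax (RGL2≥ r q q≤r)))))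
... | inj₂ r≤q = sc r r>0 (mp A∨B (∨-elim (⇒-trans A⇒q (ax (RGL2≥ q r r≤q))) B⇒r))

⊑-refl : ∀ {L} → L ⊑ L
⊑-refl = record { predᵉ = λ P → P ; funᵉ = λ f → f ; constᵉ = λ c → c
                ; predᵉ-inj = λ e → e ; funᵉ-inj = λ e → e ; constᵉ-inj = λ e → e }

trF-⊑-refl : ∀ {L n} (φ : Formula L n) → trF ⊑-refl φ ≡ φ
trF-⊑-refl φ = trans (trF-as-mapF ⊑-refl φ) (mapF-id φ)

module FreshConstants (L : Language) where
  L⁺ : Language
  L⁺ = record
    { Pred = Pred L ; Fun = Fun L ; Const = Const L ⊎ ℕ
    ; Pred-countable = Pred-countable L ; Fun-countable = Fun-countable L
    ; Const-countable = countable-⊎ (Const-countable L) countable-ℕ }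

  L⊑L⁺ : L ⊑ L⁺
  L⊑L⁺ = record { predᵉ = λ P → P ; funᵉ = λ f → f ; constᵉ = inj₁
                ; predᵉ-inj = λ e → e ; funᵉ-inj = λ e → e ; constᵉ-inj = inj₁-injective }

  fresh : ∀ {n} → ℕ → Term L⁺ n
  fresh j = const (inj₂ j)

  -- supNewF φ ≤ j says that every fresh constant cᵢ occurring in φ has i < j.
  supNewT  : ∀ {n} → Term L⁺ n → ℕ
  supNewTs : ∀ {n k} → Vec (Term L⁺ n) k → ℕ
  supNewT (var i)          = 0
  supNewT (const (inj₁ c)) = 0
  supNewT (const (inj₂ j)) = suc j
  supNewT (app f ts)       = supNewTs ts
  supNewTs []       = 0
  supNewTs (t ∷ ts) = supNewT t ⊔ supNewTs ts

  supNewF : ∀ {n} → Formula L⁺ n → ℕ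
  supNewF (atom P ts) = supNewTs ts
  supNewF (rc r)      = 0
  supNewF (φ ∧̇ ψ)     = supNewF φ ⊔ supNewF ψ
  supNewF (φ ⇒ ψ)     = supNewF φ ⊔ supNewF ψ
  supNewF (∀̇ φ)       = supNewF φ
  supNewF (∃̇ φ)       = supNewF φ

  supNewT-renT : ∀ {n m} (ρ : Fin n → Fin m) (t : Term L⁺ n) → supNewT (renT ρ t) ≡ supNewT t
  supNewTs-renTs : ∀ {n m k} (ρ : Fin n → Fin m) (ts : Vec (Term L⁺ n) k) →
                   supNewTs (renTs ρ ts) ≡ supNewTs ts
  supNewT-renT ρ (var i)          = refl
  supNewT-renT ρ (const (inj₁ c)) = refl
  supNewT-renT ρ (const (inj₂ j)) = refl
  supNewT-renT ρ (app f ts)       = supNewTs-renTs ρ ts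
  supNewTs-renTs ρ []       = refl
  supNewTs-renTs ρ (t ∷ ts) = cong₂ _⊔_ (supNewT-renT ρ t) (supNewTs-renTs ρ ts)

  module _ {n m} (σ : Fin n → Term L⁺ m) {B : ℕ} (σ≤B : ∀ i → supNewT (σ i) ≤ℕ B) where
    supNewT-subT : (t : Term L⁺ n) → supNewT t ≤ℕ B → supNewT (subT σ t) ≤ℕ B
    supNewTs-subTs : ∀ {k} (ts : Vec (Term L⁺ n) k) → supNewTs ts ≤ℕ B → supNewTs (subTs σ ts) ≤ℕ B
    supNewT-subT (var i)          _ = σ≤B i
    supNewT-subT (const (inj₁ c)) b = b
    supNewT-subT (const (inj₂ j)) b = b
    supNewT-subT (app f ts)       b = supNewTs-subTs ts b
    supNewTs-subTs []       b = b
    supNewTs-subTs (t ∷ ts) b =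
      ⊔-lub (supNewT-subT t (ℕ.m⊔n≤o⇒m≤o _ _ b)) (supNewTs-subTs ts (ℕ.m⊔n≤o⇒n≤o (supNewT t) _ b))

  supNewT-extS : ∀ {n m} (σ : Fin n → Term L⁺ m) {B : ℕ} → (∀ i → supNewT (σ i) ≤ℕ B) →
                 ∀ i → supNewT (extS σ i) ≤ℕ B
  supNewT-extS σ σ≤B zero    = z≤n
  supNewT-extS σ σ≤B (suc i) = subst (_≤ℕ _) (sym (supNewT-renT suc (σ i))) (σ≤B i)

  supNewF-subF : ∀ {n m} (σ : Fin n → Term L⁺ m) {B : ℕ} → (∀ i → supNewT (σ i) ≤ℕ B) →
                 (φ : Formula L⁺ n) → supNewF φ ≤ℕ B → supNewF (subF σ φ) ≤ℕ B
  supNewF-subF σ σ≤B (atom P ts) b = supNewTs-subTs σ σ≤B ts b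
  supNewF-subF σ σ≤B (rc r)      b = b
  supNewF-subF σ σ≤B (φ ∧̇ ψ)     b =
    ⊔-lub (supNewF-subF σ σ≤B φ (ℕ.m⊔n≤o⇒m≤o _ _ b))
          (supNewF-subF σ σ≤B ψ (ℕ.m⊔n≤o⇒n≤o (supNewF φ) _ b))
  supNewF-subF σ σ≤B (φ ⇒ ψ)     b =
    ⊔-lub (supNewF-subF σ σ≤B φ (ℕ.m⊔n≤o⇒m≤o _ _ b))
          (supNewF-subF σ σ≤B ψ (ℕ.m⊔n≤o⇒n≤o (supNewF φ) _ b))
  supNewF-subF σ σ≤B (∀̇ φ)       b = supNewF-subF (extS σ) (supNewT-extS σ σ≤B) φ b
  supNewF-subF σ σ≤B (∃̇ φ)       b = supNewF-subF (extS σ) (supNewT-extS σ σ≤B) φ b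

  supNewF-[fresh] : ∀ (φ : Formula L⁺ 1) j → supNewF φ ≤ℕ j → supNewF (φ [ fresh j ]) ≤ℕ suc j
  supNewF-[fresh] φ j b = supNewF-subF _ (λ { zero → ℕ.≤-refl }) φ (ℕ.≤-trans b (n≤1+n j))

  supNewTs-trTs : ∀ {n k} (ts : Vec (Term L n) k) → supNewTs (trTs L⊑L⁺ ts) ≡ 0
  supNewTs-trTs []              = refl
  supNewTs-trTs (var i ∷ ts)    = supNewTs-trTs ts
  supNewTs-trTs (const c ∷ ts)  = supNewTs-trTs ts
  supNewTs-trTs (app f us ∷ ts) = cong₂ _⊔_ (supNewTs-trTs us) (supNewTs-trTs ts)

  supNewF-trF : ∀ {n} (φ : Formula L n) → supNewF (trF L⊑L⁺ φ) ≡ 0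
  supNewF-trF (atom P ts) = supNewTs-trTs ts
  supNewF-trF (rc r)      = refl
  supNewF-trF (φ ∧̇ ψ)     = cong₂ _⊔_ (supNewF-trF φ) (supNewF-trF ψ)
  supNewF-trF (φ ⇒ ψ)     = cong₂ _⊔_ (supNewF-trF φ) (supNewF-trF ψ)
  supNewF-trF (∀̇ φ)       = supNewF-trF φ
  supNewF-trF (∃̇ φ)       = supNewF-trF φ

  FixesAllBut : ℕ → ∀ {m} → (Const L⁺ → Term L⁺ m) → Set
  FixesAllBut j γ = ∀ d → d ≢ inj₂ j → γ d ≡ const d

  module _ {j n m} (σ : Fin n → Term L⁺ m) {γ : Const L⁺ → Term L⁺ m} (γ-fixes : FixesAllBut j γ) where
    mapT-avoiding : (t : Term L⁺ n) → supNewT t ≤ℕ j → mapT idˢ σ γ t ≡ mapT idˢ σ const t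
    mapTs-avoiding : ∀ {k} (ts : Vec (Term L⁺ n) k) → supNewTs ts ≤ℕ j →
                     mapTs idˢ σ γ ts ≡ mapTs idˢ σ const ts
    mapT-avoiding (var i)          _ = refl
    mapT-avoiding (const (inj₁ c)) _ = γ-fixes (inj₁ c) (λ ())
    mapT-avoiding (const (inj₂ i)) b = γ-fixes (inj₂ i) (λ e → ℕ.<-irrefl (inj₂-injective e) b)
    mapT-avoiding (app f ts)       b = cong (app f) (mapTs-avoiding ts b)
    mapTs-avoiding []       _ = refl
    mapTs-avoiding (t ∷ ts) b =
      cong₂ _∷_ (mapT-avoiding t (ℕ.m⊔n≤o⇒m≤o _ _ b)) (mapTs-avoiding ts (ℕ.m⊔n≤o⇒n≤o (supNewT t) _ b))

  mapF-avoiding : ∀ {j n m} (σ : Fin n → Term L⁺ m) {γ : Const L⁺ → Term L⁺ m} → FixesAllBut j γ →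
                  (φ : Formula L⁺ n) → supNewF φ ≤ℕ j → mapF idˢ σ γ φ ≡ mapF idˢ σ const φ
  mapF-avoiding σ γ-fixes (atom P ts) b = cong (atom P) (mapTs-avoiding σ γ-fixes ts b)
  mapF-avoiding σ γ-fixes (rc r)      b = refl
  mapF-avoiding σ γ-fixes (φ ∧̇ ψ)     b =
    cong₂ _∧̇_ (mapF-avoiding σ γ-fixes φ (ℕ.m⊔n≤o⇒m≤o _ _ b))
              (mapF-avoiding σ γ-fixes ψ (ℕ.m⊔n≤o⇒n≤o (supNewF φ) _ b))
  mapF-avoiding σ γ-fixes (φ ⇒ ψ)     b =
    cong₂ _⇒_ (mapF-avoiding σ γ-fixes φ (ℕ.m⊔n≤o⇒m≤o _ _ b))
              (mapF-avoiding σ γ-fixes ψ (ℕ.m⊔n≤o⇒n≤o (supNewF φ) _ b))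
  mapF-avoiding σ γ-fixes (∀̇ φ)       b =
    cong ∀̇ (mapF-avoiding (extS σ) (λ d d≢j → cong (renT suc) (γ-fixes d d≢j)) φ b)
  mapF-avoiding σ γ-fixes (∃̇ φ)       b =
    cong ∃̇ (mapF-avoiding (extS σ) (λ d d≢j → cong (renT suc) (γ-fixes d d≢j)) φ b)

  abstractAt : ℕ → Const L⁺ → Term L⁺ 1
  abstractAt j (inj₁ c) = const (inj₁ c)
  abstractAt j (inj₂ i) with i ≟ j
  ... | yes _ = var zero
  ... | no _  = fresh i

  abstractAt-fixes : ∀ j → FixesAllBut j (abstractAt j)
  abstractAt-fixes j (inj₁ c) _ = refl
  abstractAt-fixes j (inj₂ i) i≢j with i ≟ j
  ... | yes refl = ⊥-elim (i≢j refl)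
  ... | no _     = refl

  abstractAt-self : ∀ j → abstractAt j (inj₂ j) ≡ var zero
  abstractAt-self j with j ≟ j
  ... | yes _  = refl
  ... | no j≢j = ⊥-elim (j≢j refl)

  abstract-instantiate : ∀ (φ : Formula L⁺ 1) j → supNewF φ ≤ℕ j →
                         mapF idˢ (λ ()) (abstractAt j) (φ [ fresh j ]) ≡ φ
  abstract-instantiate φ j b =
    trans (cong (mapF idˢ (λ ()) (abstractAt j)) (subF-as-mapF _ φ))
     (trans (mapF-mapF idˢ idˢ (λ ()) (abstractAt j) _ const φ)
      (trans (mapF-cong idˢ (λ { zero → abstractAt-self j }) (λ _ → refl) φ)
       (trans (mapF-avoiding var (abstractAt-fixes j) φ b) (mapF-id φ))))

  -- A constant that does not occur in the hypotheses can be replaced by a variable.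
  ⊢-abstract : ∀ {U : Theory L⁺} j → (∀ χ → U χ → supNewF χ ≤ℕ j) →
               ∀ {n m} (σ : Fin n → Term L⁺ m) (γ : Const L⁺ → Term L⁺ m) → FixesAllBut j γ →
               {ψ : Formula L⁺ n} → U ⊢ ψ → U ⊢ mapF idˢ σ γ ψ
  ⊢-abstract {U} j U≤j =
    ⊢-mapF idˢ (FixesAllBut j) (λ γ-fixes d d≢j → cong (renT suc) (γ-fixes d d≢j))
      λ {_} {γ} {χ} γ-fixes χ∈U →
        subst (U ⊢_) (sym (trans (mapF-avoiding (λ ()) γ-fixes χ (U≤j χ χ∈U)) (mapF-sentence _ χ)))
              (hyp χ∈U)

  -- A refutation of φ(cⱼ) → s̄ to degree q gives (φ → s̄) → q̄ after abstracting cⱼ; then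
  -- prelinearity and G∀3 yield q̄ ∨ ∀x (s̄ → φ), and ∀x (s̄ → φ) implies s̄ → r̄, i.e. r̄.
  henkin-step : ∀ {U : Theory L⁺} j (φ : Formula L⁺ 1) {r s : ℚ01} →
                StronglyConsistent U → (∀ χ → U χ → supNewF χ ≤ℕ j) → supNewF φ ≤ℕ j →
                U ⊢ ∀̇ φ ⇒ rc r → 0ℚ < val s → val s < val r →
                StronglyConsistent (U ∪｛ φ [ fresh j ] ⇒ rc s ｝)
  henkin-step {U} j φ {r} {s} sc U≤j φ≤j ∀φ⇒r s>0 s<r q q>0 d =
    sc-refutes-∨ sc q>0 (ℚ.<-trans s>0 s<r) q∨∀ ⇒-refl ∀⇒r
    where
    witness⇒q : U ⊢ (φ [ fresh j ] ⇒ rc s) ⇒ rc q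
    witness⇒q = deduction₀ d
    φ⇒q : U ⊢ (φ ⇒ rc s) ⇒ rc q
    φ⇒q = subst (λ θ → U ⊢ (θ ⇒ rc s) ⇒ rc q) (abstract-instantiate φ j φ≤j)
                (⊢-abstract j U≤j (λ ()) (abstractAt j) (abstractAt-fixes j) witness⇒q)
    q∨∀ : U ⊢ rc q ∨̇ ∀̇ (rc s ⇒ φ)
    q∨∀ = mp (gen (mp prelinearity (∨-elim (⇒-trans φ⇒q ∨-introˡ) ∨-introʳ)))
             (ax (G∀3 (rc q) (rc s ⇒ φ)))
    ∀⇒r : U ⊢ ∀̇ (rc s ⇒ φ) ⇒ rc r
    ∀⇒r = ⇒-trans (⇒-post (ax (G∀2 (rc s) φ)) ∀φ⇒r) (⇔-elimˡ (ax (RGL2< s r s<r)))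

HenkinCompletion : (L : Language) → Theory L → Set₁
HenkinCompletion L T =
  Σ Language λ L̂ → Σ (L ⊑ L̂) λ ι → Σ (Theory L̂) λ T̂ →
    MaximallyStronglyConsistent T̂ × Henkin T̂ × T ⊆[ ι ] T̂

module Completion (lem : ExcludedMiddle 0ℓ) (L : Language) (T : Theory L) where
  open FreshConstants L

  T⁺ : Theory L⁺
  T⁺ χ = Σ (Sentence L) λ φ → T φ × trF L⊑L⁺ φ ≡ χ

  module Witnessed (sc⁺ : StronglyConsistent T⁺) where
    Refuted : Theory L⁺ → Formula L⁺ 1 → Set
    Refuted U φ = Σ ℚ01 λ r → 0ℚ < val r × U ⊢ ∀̇ φ ⇒ rc r

    addWitness : (U : Theory L⁺) (b : ℕ) (φ : Formula L⁺ 1) → Dec (Refuted U φ) → Theory L⁺ × ℕ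
    addWitness U b φ (yes (r , r>0 , _)) =
      U ∪｛ φ [ fresh j ] ⇒ rc (proj₁ (dense-below r r>0)) ｝ , suc j
      where j = b ⊔ supNewF φ
    addWitness U b φ (no _) = U , b

    caseUniversal : ∀ {a} {A : Set a} → Sentence L⁺ → (Formula L⁺ 1 → A) → A → A
    caseUniversal (∀̇ φ) f a = f φ
    caseUniversal _     f a = a

    caseUniversal-elim : ∀ {a} {A : Set a} (P : A → Set) (ψ : Sentence L⁺) {f : Formula L⁺ 1 → A} {a : A} →
                         (∀ φ → P (f φ)) → P a → P (caseUniversal ψ f a)
    caseUniversal-elim P (atom _ _) Pf Pa = Pa
    caseUniversal-elim P (rc _)     Pf Pa = Pa
    caseUniversal-elim P (_ ∧̇ _)    Pf Pa = Pa
    caseUniversal-elim P (_ ⇒ _)    Pf Pa = Pa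
    caseUniversal-elim P (∀̇ φ)      Pf Pa = Pf φ
    caseUniversal-elim P (∃̇ _)      Pf Pa = Pa

    reject : Theory L⁺ → ℕ → Sentence L⁺ → Theory L⁺ × ℕ
    reject U b ψ = caseUniversal ψ (λ φ → addWitness U b φ lem) (U , b)

    Good : Theory L⁺ → ℕ → Set
    Good U b = StronglyConsistent U × (∀ χ → U χ → supNewF χ ≤ℕ b)

    good₀ : Good T⁺ 0
    good₀ = sc⁺ , λ { χ (φ , _ , refl) → ℕ.≤-reflexive (supNewF-trF φ) }

    good-accept : ∀ {U b ψ} → Good U b → StronglyConsistent (U ∪｛ ψ ｝) →
                  Good (U ∪｛ ψ ｝) (b ⊔ supNewF ψ)
    good-accept {b = b} {ψ} (_ , U≤b) sc′ =
      sc′ , λ { χ (inj₁ h) → ℕ.≤-trans (U≤b χ h) (m≤m⊔n b (supNewF ψ))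
              ; χ (inj₂ refl) → m≤n⊔m b (supNewF ψ) }

    good-addWitness : ∀ {U b φ} → Good U b → (d : Dec (Refuted U φ)) →
                      Good (proj₁ (addWitness U b φ d)) (proj₂ (addWitness U b φ d))
    good-addWitness {U} {b} {φ} (sc , U≤b) (yes (r , r>0 , ∀φ⇒r)) =
      henkin-step j φ sc U≤j (m≤n⊔m b (supNewF φ)) ∀φ⇒r s>0 s<r ,
      λ { χ (inj₁ h) → ℕ.≤-trans (U≤j χ h) (n≤1+n j)
        ; χ (inj₂ refl) → ⊔-lub (supNewF-[fresh] φ j (m≤n⊔m b (supNewF φ))) z≤n }
      where
      j = b ⊔ supNewF φ
      U≤j : ∀ χ → U χ → supNewF χ ≤ℕ j
      U≤j χ h = ℕ.≤-trans (U≤b χ h) (m≤m⊔n b (supNewF φ))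
      s>0 = proj₁ (proj₂ (dense-below r r>0))
      s<r = proj₂ (proj₂ (dense-below r r>0))
    good-addWitness g (no _) = g

    good-reject : ∀ {U b ψ} → Good U b → ¬ StronglyConsistent (U ∪｛ ψ ｝) →
                  Good (proj₁ (reject U b ψ)) (proj₂ (reject U b ψ))
    good-reject {ψ = ψ} g _ =
      caseUniversal-elim (λ p → Good (proj₁ p) (proj₂ p)) ψ (λ φ → good-addWitness g lem) g

    ⊆-reject : ∀ {U b ψ} → U ⊆ᵀ proj₁ (reject U b ψ)
    ⊆-reject {U} {b} {ψ} = caseUniversal-elim (λ p → U ⊆ᵀ proj₁ p) ψ (λ φ → ⊆-addWitness lem) (λ χ h → h)
      where
      ⊆-addWitness : ∀ {φ} (d : Dec (Refuted U φ)) → U ⊆ᵀ proj₁ (addWitness U b φ d)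
      ⊆-addWitness (yes _) χ h = inj₁ h
      ⊆-addWitness (no _)  χ h = h

    refuted-of-¬sc : ∀ {U φ} → ¬ StronglyConsistent (U ∪｛ ∀̇ φ ｝) → Refuted U φ
    refuted-of-¬sc {U} {φ} ¬sc with lem {Σ ℚ01 λ r → 0ℚ < val r × U ∪｛ ∀̇ φ ｝ ⊢ rc {n = 0} r}
    ... | yes (r , r>0 , d) = r , r>0 , deduction₀ d
    ... | no ¬refuted      = ⊥-elim (¬sc λ r r>0 d → ¬refuted (r , r>0 , d))

    witness-added : ∀ {U b φ} (d : Dec (Refuted U φ)) → Refuted U φ →
                    Σ ℕ λ j → Σ ℚ01 λ s → 0ℚ < val s × proj₁ (addWitness U b φ d) (φ [ fresh j ] ⇒ rc s)
    witness-added {b = b} {φ} (yes (r , r>0 , _)) _ =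
      b ⊔ supNewF φ , proj₁ (dense-below r r>0) , proj₁ (proj₂ (dense-below r r>0)) , inj₂ refl
    witness-added (no ¬refuted) refuted = ⊥-elim (¬refuted refuted)

    open Lindenbaum lem L⁺ T⁺ supNewF Good good₀ proj₁ good-accept reject good-reject
                    (λ {U} {b} {ψ} → ⊆-reject {U} {b} {ψ})

    T̂-henkin : Henkin T̂
    T̂-henkin φ T̂⊬∀φ = from-verdict (verdict (∀̇ φ))
      where
      k = FormulaCoding.codeF L⁺ (∀̇ φ)
      from-verdict : Verdict (∀̇ φ) → ∃ λ c → ¬ (T̂ ⊢ φ [ const c ])
      from-verdict (inj₁ (_ , ∀φ∈Th)) = ⊥-elim (T̂⊬∀φ (hyp₀ (Th-⊆-T̂ (suc k) _ ∀φ∈Th)))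
      from-verdict (inj₂ (¬sc , reject⊆Th))
        with j , s , s>0 , witness ← witness-added {b = proj₂ (stage k)} lem (refuted-of-¬sc ¬sc) =
        inj₂ j , λ T̂⊢φc → T̂-sc s s>0 (mp T̂⊢φc (hyp₀ (Th-⊆-T̂ (suc k) _ (reject⊆Th _ witness))))

    completion : HenkinCompletion L T
    completion =
      L⁺ , L⊑L⁺ , T̂ , T̂-maximally-sc , T̂-henkin , λ φ φ∈T → Th-⊆-T̂ 0 (trF L⊑L⁺ φ) (φ , φ∈T , refl)

  -- Derivations may use a free variable over a possibly empty domain, so T⁺ can fail to be
  -- strongly consistent although T is; then T proves some r̄ only under a free variable.
  -- In that case T ∪ {∀x 1̄} is strongly consistent, and every theory containing ∀x 1̄
  -- proves all universal sentences, hence is vacuously Henkin.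
  module Degenerate (sc : StronglyConsistent T) (¬sc⁺ : ¬ StronglyConsistent T⁺) where
    forget : SymbolMap L⁺ L
    forget = record { onPred = λ P → P ; onFun = λ f → f }

    FixesOld : ∀ {m} → (Const L⁺ → Term L m) → Set
    FixesOld γ = ∀ c → γ (inj₁ c) ≡ const c

    forget-hyp : ∀ {m} {γ : Const L⁺ → Term L m} {χ} → FixesOld γ → T⁺ χ →
                 T ⊢ mapF forget (λ ()) γ χ
    forget-hyp {γ = γ} γ-fixes (φ , φ∈T , refl) =
      subst (T ⊢_) (sym forget-trF) (hyp φ∈T)
      where
      forget-trF : mapF forget (λ ()) γ (trF L⊑L⁺ φ) ≡ emb φ
      forget-trF =
        trans (cong (mapF forget (λ ()) γ) (trF-as-mapF L⊑L⁺ φ))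
          (trans (mapF-mapF forget (symbolsOf L⊑L⁺) (λ ()) γ var (λ c → const (inj₁ c)) φ)
                 (trans (mapF-cong idˢ (λ ()) γ-fixes φ) (mapF-sentence (λ ()) φ)))

    freshToVar : Const L⁺ → Term L 1
    freshToVar (inj₁ c) = const c
    freshToVar (inj₂ _) = var zero

    open-refutation : Σ ℚ01 λ r → 0ℚ < val r × T ⊢ rc {n = 1} r
    open-refutation with lem {Σ ℚ01 λ r → 0ℚ < val r × T⁺ ⊢ rc {n = 0} r}
    ... | yes (r , r>0 , d) =
      r , r>0 , ⊢-mapF forget FixesOld (λ γ-fixes c → cong (renT suc) (γ-fixes c)) forget-hyp
                       (λ ()) freshToVar (λ _ → refl) d
    ... | no ¬refuted = ⊥-elim (¬sc⁺ λ r r>0 d → ¬refuted (r , r>0 , d))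

    T₁ : Theory L
    T₁ = T ∪｛ ∀̇ (rc one01) ｝

    T₁-sc : StronglyConsistent T₁
    T₁-sc q q>0 d with r , r>0 , T⊢r ← open-refutation =
      sc-refutes-∨ sc r>0 q>0 (mp (gen (mp T⊢r ∨-introˡ)) (ax (G∀3 (rc r) (rc one01))))
                   ⇒-refl (deduction₀ d)

    open Lindenbaum lem L T₁ (λ _ → 0) (λ U _ → StronglyConsistent U) T₁-sc (λ sc → sc)
                    (λ _ sc → sc) (λ U b _ → U , b) (λ sc _ → sc) (λ χ h → h)

    T̂-henkin : Henkin T̂
    T̂-henkin φ T̂⊬∀φ = ⊥-elim (T̂⊬∀φ (gen (mp (mp (hyp ∀1∈T̂) (ax (G∀1 (rc one01) (var zero)))) (ax (G7 φ)))))
      where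
      ∀1∈T̂ : T̂ (∀̇ (rc one01))
      ∀1∈T̂ = Th-⊆-T̂ 0 _ (inj₂ refl)

    completion : HenkinCompletion L T
    completion =
      L , ⊑-refl , T̂ , T̂-maximally-sc , T̂-henkin ,
      λ φ φ∈T → subst T̂ (sym (trF-⊑-refl φ)) (Th-⊆-T̂ 0 φ (inj₁ φ∈T))

mainTheorem9 : ExcludedMiddle 0ℓ →
    (L : Language) (T : Theory L) → StronglyConsistent T →
    Σ Language λ L̂ → Σ (L ⊑ L̂) λ ι → Σ (Theory L̂) λ T̂ →
      MaximallyStronglyConsistent T̂ × Henkin T̂ × T ⊆[ ι ] T̂
mainTheorem9 lem L T sc with lem {StronglyConsistent (Completion.T⁺ lem L T)}
... | yes sc⁺ = Completion.Witnessed.completion lem L T sc⁺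
... | no ¬sc⁺ = Completion.Degenerate.completion lem L T sc ¬sc⁺
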